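{- Let $\nu,\beta\in\mathbb N^n$, let $0\le p\le k<n$ and $1\le r_1<\cdots<r_k<n$. The following three conditions are equivalent: (a) $\beta\not\le\omega s_{r_k}\cdots\widehat{s_{r_i}}\cdots s_{r_1}\nu$ for $i=1,\dots,k$, and $\beta\le\omega s_{r_k}\cdots s_{r_1}\nu$. (b) $s_{n-r_1}\cdots\widehat{s_{n-r_i}}\cdots s_{n-r_k}\beta\not\le\omega\nu$ for $i=1,\dots,k$, and $s_{n-r_1}\cdots s_{n-r_k}\beta\le\omega\nu$. (c) $s_{n-r_{k-p+1}}\cdots s_{n-r_k}\beta\not\le\omega s_{r_{k-p}}\cdots\widehat{s_{r_i}}\cdots s_{r_1}\nu$ for $i=1,\dots,k-p$; $s_{n-r_{k-p+1}}\cdots\widehat{s_{n-r_i}}\cdots s_{n-r_k}\beta\not\le\omega s_{r_{k-p}}\cdots s_{r_1}\nu$ for $i=k-p+1,\dots,k$; and $s_{n-r_{k-p+1}}\cdots s_{n-r_k}\beta\le\omega s_{r_{k-p}}\cdots s_{r_1}\nu$. Here $\widehat{\ }$ denotes omission of the factor.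
   Context: $\mathfrak S_n$ acts on $\mathbb N^n$ by permuting positions; $s_i$ swaps entries $i,i+1$; a product $s_as_b\alpha$ means $s_a(s_b\alpha)$; $\omega$ is the longest permutation, $\omega(\alpha_1,\dots,\alpha_n)=(\alpha_n,\dots,\alpha_1)$. Bruhat order on $\mathbb N^n$: $\alpha\le\gamma$ iff $\gamma$ is obtained from $\alpha$ by a finite (possibly empty) sequence of steps, each replacing the current vector $\delta$ by $t\delta$ with $t=(i\,j)$, $i<j$, $\delta_i>\delta_j$; in particular $\alpha\le\gamma$ forces $\alpha,\gamma$ to be rearrangements of each other. $\not\le$ means the relation fails. -}

module Defs where

open import Data.Nat using (ℕ; zero; suc; _∸_; _+_; _≤_; _<_; _>_; _≡ᵇ_)
open import Data.Bool using (not)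
open import Data.Fin using (Fin) renaming (_<_ to _<ᶠ_)
open import Data.Vec using (Vec; []; _∷_; lookup; _[_]≔_; reverse)
open import Data.List using (List; map; upTo; filterᵇ) renaming (reverse to rev; [] to nil; _∷_ to _::_)
open import Data.Product using (Σ; ∃; _×_)
open import Relation.Binary.PropositionalEquality using (_≡_)
open import Relation.Binary.Construct.Closure.ReflexiveTransitive using (Star)
open import Relation.Nullary using (¬_)

-- s i : swap entries i and i+1 (1-indexed); identity if i ∉ {1,…,n-1}
s : {n : ℕ} → ℕ → Vec ℕ n → Vec ℕ n
s (suc zero) (x ∷ y ∷ v) = y ∷ x ∷ v
s (suc (suc i)) (x ∷ v) = x ∷ s (suc i) v
s _ v = v

sw : {n : ℕ} → List ℕ → Vec ℕ n → Vec ℕ n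
sw nil α = α
sw (a :: w) α = s a (sw w α)

-- longest permutation ω : reversal
ω : {n : ℕ} → Vec ℕ n → Vec ℕ n
ω = reverse

swapPos : {n : ℕ} → Fin n → Fin n → Vec ℕ n → Vec ℕ n
swapPos i j δ = (δ [ i ]≔ lookup δ j) [ j ]≔ lookup δ i

Step : {n : ℕ} → Vec ℕ n → Vec ℕ n → Set
Step {n} δ δ' = Σ (Fin n) λ i → Σ (Fin n) λ j →
  (i <ᶠ j) × (lookup δ i > lookup δ j) × (δ' ≡ swapPos i j δ)

_≤B_ : {n : ℕ} → Vec ℕ n → Vec ℕ n → Set
α ≤B γ = Star Step α γ

_≰B_ : {n : ℕ} → Vec ℕ n → Vec ℕ n → Set
α ≰B γ = ¬ (α ≤B γ)

-- [a , a+1 , … , b]  (empty if b < a)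
asc : ℕ → ℕ → List ℕ
asc a b = map (a +_) (upTo (suc b ∸ a))

desc : ℕ → ℕ → List ℕ
desc a b = rev (asc a b)

omit : ℕ → List ℕ → List ℕ
omit i = filterᵇ (λ j → not (j ≡ᵇ i))

-- Conditions (a), (b), (c); r j is r_j for 1 ≤ j ≤ k.
condA : (n : ℕ) (ν β : Vec ℕ n) (k : ℕ) (r : ℕ → ℕ) → Set
condA n ν β k r =
  (∀ i → 1 ≤ i → i ≤ k → β ≰B ω (sw (map r (omit i (desc 1 k))) ν))
  × (β ≤B ω (sw (map r (desc 1 k)) ν))

condB : (n : ℕ) (ν β : Vec ℕ n) (k : ℕ) (r : ℕ → ℕ) → Set
condB n ν β k r =
  (∀ i → 1 ≤ i → i ≤ k → sw (map (λ j → n ∸ r j) (omit i (asc 1 k))) β ≰B ω ν)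
  × (sw (map (λ j → n ∸ r j) (asc 1 k)) β ≤B ω ν)

condC : (n : ℕ) (ν β : Vec ℕ n) (k p : ℕ) (r : ℕ → ℕ) → Set
condC n ν β k p r =
  (∀ i → 1 ≤ i → i ≤ k ∸ p →
     sw (map (λ j → n ∸ r j) (asc (suc (k ∸ p)) k)) β
       ≰B ω (sw (map r (omit i (desc 1 (k ∸ p)))) ν))
  × (∀ i → k ∸ p < i → i ≤ k →
     sw (map (λ j → n ∸ r j) (omit i (asc (suc (k ∸ p)) k))) β
       ≰B ω (sw (map r (desc 1 (k ∸ p))) ν))
  × (sw (map (λ j → n ∸ r j) (asc (suc (k ∸ p)) k)) β
       ≤B ω (sw (map r (desc 1 (k ∸ p))) ν))

-- Put μ = ω ν and g j = n ∸ r j. Since ω s_c = s_(n-c) ω, each of (a), (b), (c) says that a pair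
-- of words u, v in the letters g j is tight: s_u β ≤ s_v μ, while deleting any single letter of u
-- or of v destroys the inequality. In a tight pair of words without repeated letters, every letter
-- of v is an ascent at the point where it acts: otherwise deleting it could only increase s_v μ,
-- since the step it undoes crosses the cut at that letter and so survives the letters in front of
-- it, which all differ from it. Dually every letter of u is a descent. Hence s_v μ may be replaced
-- by the Demazure-type maximum T_v μ and s_u β by the minimum B_u β, and a subword argument shows
-- that the deletion conditions survive. The lifting property of the Bruhat order makes B_c and T_c
-- adjoint, B_c x ≤ Y ⇔ x ≤ T_c Y, so a letter can move from the front of v to the front of u
-- without affecting tightness; moving the letters one at a time passes from (a) through (c) to (b).
module Submission where

open import Defs
open import Data.Bool using (Bool; true; false; if_then_else_; T; not)
open import Data.Bool.Properties using (T-≡; ¬-not)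
open import Data.Empty using (⊥-elim)
open import Data.Fin using (Fin; toℕ) renaming (zero to fzero; suc to fsuc)
open import Data.Fin.Properties using () renaming (_≟_ to _≟ᶠ_)
open import Data.Nat using (ℕ; zero; suc; _∸_; _+_; _≤_; _<_; _>_; _<ᵇ_; _≡ᵇ_; z≤n; s≤s)
open import Data.Nat.Properties
open import Data.List using (List; []; _∷_; _++_; map; reverse; upTo; applyUpTo; applyDownFrom)
open import Data.List.Properties using (++-assoc; map-∘; map-cong; map-upTo; reverse-applyUpTo)
open import Data.List.Membership.Propositional using (_∈_)
open import Data.List.Membership.Propositional.Properties using (∈-map⁺; ∈-map⁻; ∈-upTo⁺; ∈-upTo⁻)
open import Data.List.Relation.Binary.Sublist.Propositional using (_⊆_)
open import Data.List.Relation.Unary.All as All using (All; []; _∷_; head; tail)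
open import Data.List.Relation.Unary.All.Properties using (++⁺; ++⁻ˡ; ++⁻ʳ; filter⁺; map⁺)
open import Data.List.Relation.Unary.Any using (here; there)
open import Data.List.Relation.Unary.Any.Properties using (reverse⁺; reverse⁻)
open import Data.List.Relation.Unary.Unique.Propositional {A = ℕ} using (Unique; []; _∷_)
import Data.List.Relation.Unary.Unique.Propositional.Properties as Unique
open import Data.Product using (Σ; ∃; _×_; _,_; proj₁; proj₂; uncurry)
open import Data.Sum using (_⊎_; inj₁; inj₂)
open import Data.Vec using (Vec; []; _∷_; lookup; _[_]≔_)
open import Data.Vec.Properties
  using (reverse-∷; lookup∘update; lookup∘update′; tabulate∘lookup; tabulate-cong)
open import Function using (_∘_; _⇔_; mk⇔; Equivalence)
open import Function.Construct.Composition using (_⇔-∘_)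
open import Function.Construct.Symmetry using (⇔-sym)
open import Function.Properties.Equivalence using (⇔-setoid)
open import Level using (0ℓ)
open import Relation.Binary.Construct.Closure.ReflexiveTransitive using (ε; _◅_; _◅◅_)
open import Relation.Binary.Definitions using (tri<; tri≈; tri>)
open import Relation.Binary.PropositionalEquality
import Relation.Binary.Reasoning.Setoid as ≈-Reasoning
open import Relation.Nullary using (¬_; yes; no)
open import Relation.Nullary.Decidable using (T?)

-- Positions are 0-indexed: s a exchanges positions a - 1 and a (and is the identity out of range).
s-pos : ∀ {n} → ℕ → Fin n → Fin n
s-pos {suc (suc _)} 1 fzero = fsuc fzero
s-pos 1 (fsuc fzero) = fzero
s-pos (suc (suc a)) (fsuc k) = fsuc (s-pos (suc a) k)
s-pos _ k = k

lookup-s : ∀ {n} a (v : Vec ℕ n) k → lookup (s a v) k ≡ lookup v (s-pos a k)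
lookup-s zero v k = refl
lookup-s 1 (x ∷ []) fzero = refl
lookup-s 1 (x ∷ y ∷ v) fzero = refl
lookup-s 1 (x ∷ y ∷ v) (fsuc fzero) = refl
lookup-s 1 (x ∷ y ∷ v) (fsuc (fsuc k)) = refl
lookup-s (suc (suc a)) (x ∷ v) fzero = refl
lookup-s (suc (suc a)) (x ∷ v) (fsuc k) = lookup-s (suc a) v k

s-pos-involutive : ∀ {n} a (k : Fin n) → s-pos a (s-pos a k) ≡ k
s-pos-involutive zero k = refl
s-pos-involutive {1} 1 fzero = refl
s-pos-involutive {suc (suc _)} 1 fzero = refl
s-pos-involutive 1 (fsuc fzero) = refl
s-pos-involutive 1 (fsuc (fsuc k)) = refl
s-pos-involutive (suc (suc a)) fzero = refl
s-pos-involutive (suc (suc a)) (fsuc k) = cong fsuc (s-pos-involutive (suc a) k)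

s-involutive : ∀ {n} a (v : Vec ℕ n) → s a (s a v) ≡ v
s-involutive zero v = refl
s-involutive 1 [] = refl
s-involutive 1 (x ∷ []) = refl
s-involutive 1 (x ∷ y ∷ v) = refl
s-involutive (suc (suc a)) [] = refl
s-involutive (suc (suc a)) (x ∷ v) = cong (x ∷_) (s-involutive (suc a) v)

lookup-s-s-pos : ∀ {n} a (v : Vec ℕ n) k → lookup (s a v) (s-pos a k) ≡ lookup v k
lookup-s-s-pos a v k = trans (lookup-s a v (s-pos a k)) (cong (lookup v) (s-pos-involutive a k))

lookup-ext : ∀ {n} {u v : Vec ℕ n} → (∀ k → lookup u k ≡ lookup v k) → u ≡ v
lookup-ext {u = u} {v} eq = trans (sym (tabulate∘lookup u)) (trans (tabulate-cong eq) (tabulate∘lookup v))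

module _ {n} {i j : Fin n} (z : Vec ℕ n) where

  lookup-swapPos-right : lookup (swapPos i j z) j ≡ lookup z i
  lookup-swapPos-right = lookup∘update j (z [ i ]≔ lookup z j) (lookup z i)

  lookup-swapPos-left : i ≢ j → lookup (swapPos i j z) i ≡ lookup z j
  lookup-swapPos-left i≢j =
    trans (lookup∘update′ i≢j (z [ i ]≔ lookup z j) (lookup z i)) (lookup∘update i z (lookup z j))

  lookup-swapPos-other : ∀ {k} → k ≢ i → k ≢ j → lookup (swapPos i j z) k ≡ lookup z k
  lookup-swapPos-other k≢i k≢j =
    trans (lookup∘update′ k≢j (z [ i ]≔ lookup z j) (lookup z i)) (lookup∘update′ k≢i z (lookup z j))

module _ {n} (π : Fin n → Fin n) (π-involutive : ∀ k → π (π k) ≡ k)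
         (f : Vec ℕ n → Vec ℕ n) (lookup-f : ∀ v k → lookup (f v) k ≡ lookup v (π k)) where

  swapPos-conjugate : ∀ {i j} z → i ≢ j → f (swapPos i j z) ≡ swapPos (π i) (π j) (f z)
  swapPos-conjugate {i} {j} z i≢j = lookup-ext pointwise
    where
    lookup-f-π : ∀ v k → lookup (f v) (π k) ≡ lookup v k
    lookup-f-π v k = trans (lookup-f v (π k)) (cong (lookup v) (π-involutive k))

    π-flip : ∀ {k l} → π k ≡ l → k ≡ π l
    π-flip {k} e = trans (sym (π-involutive k)) (cong π e)

    π-injective : ∀ {k l} → π k ≡ π l → k ≡ l
    π-injective {l = l} e = trans (π-flip e) (π-involutive l)

    pointwise : ∀ k → lookup (f (swapPos i j z)) k ≡ lookup (swapPos (π i) (π j) (f z)) k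
    pointwise k with k ≟ᶠ π j | k ≟ᶠ π i
    ... | yes refl | _ = begin
      lookup (f (swapPos i j z)) (π j)          ≡⟨ lookup-f-π (swapPos i j z) j ⟩
      lookup (swapPos i j z) j                  ≡⟨ lookup-swapPos-right z ⟩
      lookup z i                                ≡⟨ lookup-f-π z i ⟨
      lookup (f z) (π i)                        ≡⟨ lookup-swapPos-right (f z) ⟨
      lookup (swapPos (π i) (π j) (f z)) (π j)  ∎
      where open ≡-Reasoning
    ... | no _ | yes refl = begin
      lookup (f (swapPos i j z)) (π i)          ≡⟨ lookup-f-π (swapPos i j z) i ⟩
      lookup (swapPos i j z) i                  ≡⟨ lookup-swapPos-left z i≢j ⟩
      lookup z j                                ≡⟨ lookup-f-π z j ⟨
      lookup (f z) (π j)                        ≡⟨ lookup-swapPos-left (f z) (i≢j ∘ π-injective) ⟨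
      lookup (swapPos (π i) (π j) (f z)) (π i)  ∎
      where open ≡-Reasoning
    ... | no k≢πj | no k≢πi = begin
      lookup (f (swapPos i j z)) k              ≡⟨ lookup-f (swapPos i j z) k ⟩
      lookup (swapPos i j z) (π k)              ≡⟨ lookup-swapPos-other z (k≢πi ∘ π-flip) (k≢πj ∘ π-flip) ⟩
      lookup z (π k)                            ≡⟨ lookup-f z k ⟨
      lookup (f z) k                            ≡⟨ lookup-swapPos-other (f z) k≢πi k≢πj ⟨
      lookup (swapPos (π i) (π j) (f z)) k      ∎
      where open ≡-Reasoning

s-swapPos : ∀ {n} a {i j : Fin n} z → i ≢ j →
            s a (swapPos i j z) ≡ swapPos (s-pos a i) (s-pos a j) (s a z)
s-swapPos a = swapPos-conjugate (s-pos a) (s-pos-involutive a) (s a) (lookup-s a)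

swapPos-adjacent : ∀ {n} (i j : Fin n) z → suc (toℕ i) ≡ toℕ j → swapPos i j z ≡ s (toℕ j) z
swapPos-adjacent fzero (fsuc fzero) (x ∷ y ∷ z) refl = refl
swapPos-adjacent (fsuc i) (fsuc (fsuc j)) (x ∷ z) e =
  cong (x ∷_) (swapPos-adjacent i (fsuc j) z (suc-injective e))

s-pos-< : ∀ {n} a (i j : Fin n) → toℕ i < toℕ j → ¬ (suc (toℕ i) ≡ a × toℕ j ≡ a) →
          toℕ (s-pos a i) < toℕ (s-pos a j)
s-pos-< zero i j i<j _ = i<j
s-pos-< 1 fzero (fsuc fzero) _ ¬adj = ⊥-elim (¬adj (refl , refl))
s-pos-< 1 fzero (fsuc (fsuc j)) _ _ = s≤s (s≤s z≤n)
s-pos-< 1 (fsuc fzero) (fsuc (fsuc j)) _ _ = s≤s z≤n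
s-pos-< 1 (fsuc (fsuc i)) (fsuc (fsuc j)) i<j _ = i<j
s-pos-< 1 (fsuc fzero) (fsuc fzero) (s≤s ()) _
s-pos-< 1 (fsuc (fsuc i)) (fsuc fzero) (s≤s ()) _
s-pos-< (suc (suc a)) fzero (fsuc j) _ _ = s≤s z≤n
s-pos-< (suc (suc a)) (fsuc i) (fsuc j) (s≤s i<j) ¬adj =
  s≤s (s-pos-< (suc a) i j i<j (λ (e₁ , e₂) → ¬adj (cong suc e₁ , cong suc e₂)))

s-pos-<-cut : ∀ {n} a c (i : Fin n) → toℕ i < c → a ≢ c → toℕ (s-pos a i) < c
s-pos-<-cut zero c i i<c _ = i<c
s-pos-<-cut {1} 1 c fzero i<c _ = i<c
s-pos-<-cut {suc (suc _)} 1 1 fzero _ a≢c = ⊥-elim (a≢c refl)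
s-pos-<-cut {suc (suc _)} 1 (suc (suc c)) fzero _ _ = s≤s (s≤s z≤n)
s-pos-<-cut 1 c (fsuc fzero) i<c _ = <-trans (s≤s z≤n) i<c
s-pos-<-cut 1 c (fsuc (fsuc i)) i<c _ = i<c
s-pos-<-cut (suc (suc a)) c fzero i<c _ = i<c
s-pos-<-cut (suc (suc a)) (suc c) (fsuc i) (s≤s i<c) a≢c =
  s≤s (s-pos-<-cut (suc a) c i i<c (a≢c ∘ cong suc))

s-pos-≥-cut : ∀ {n} a c (j : Fin n) → c ≤ toℕ j → a ≢ c → c ≤ toℕ (s-pos a j)
s-pos-≥-cut a c j c≤j a≢c = ≮⇒≥ λ lt →
  <⇒≱ (subst (λ k → toℕ k < c) (s-pos-involutive a j) (s-pos-<-cut a c (s-pos a j) lt a≢c)) c≤j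

s-step : ∀ {n} a {z : Vec ℕ n} {i j : Fin n} → toℕ i < toℕ j → lookup z i > lookup z j →
         ¬ (suc (toℕ i) ≡ a × toℕ j ≡ a) → Step (s a z) (s a (swapPos i j z))
s-step a {z} {i} {j} i<j zi>zj ¬adj =
  s-pos a i , s-pos a j , s-pos-< a i j i<j ¬adj ,
  subst₂ _>_ (sym (lookup-s-s-pos a z i)) (sym (lookup-s-s-pos a z j)) zi>zj ,
  s-swapPos a z (λ e → <⇒≢ i<j (cong toℕ e))

step-s : ∀ {n} a {z z′ : Vec ℕ n} → Step z z′ → z′ ≡ s a z ⊎ Step (s a z) (s a z′)
step-s a {z} (i , j , i<j , zi>zj , refl) with suc (toℕ i) ≟ a | toℕ j ≟ a
... | yes refl | yes j≡a = inj₁ (trans (swapPos-adjacent i j z (sym j≡a)) (cong (λ b → s b z) j≡a))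
... | no ¬i≡ | _ = inj₂ (s-step a i<j zi>zj (¬i≡ ∘ proj₁))
... | yes _ | no ¬j≡a = inj₂ (s-step a i<j zi>zj (¬j≡a ∘ proj₂))

-- The lifting property of the Bruhat order: along a chain, each step either is s a itself or is
-- conjugated by s a into another step (step-s).
liftingˡ : ∀ {n} a {z y M : Vec ℕ n} → z ≤B y → y ≤B M → s a y ≤B M → s a z ≤B M
liftingˡ a ε y≤M sy≤M = sy≤M
liftingˡ a (st ◅ z≤y) y≤M sy≤M with step-s a st
... | inj₁ refl = z≤y ◅◅ y≤M
... | inj₂ st′ = st′ ◅ liftingˡ a z≤y y≤M sy≤M

liftingʳ : ∀ {n} a {m x Y : Vec ℕ n} → m ≤B x → m ≤B s a x → x ≤B Y → m ≤B s a Y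
liftingʳ a m≤x m≤sx ε = m≤sx
liftingʳ a {m} {x} m≤x m≤sx (st ◅ x≤Y) with step-s a st
... | inj₁ refl = liftingʳ a (m≤x ◅◅ st ◅ ε) (subst (m ≤B_) (sym (s-involutive a x)) m≤x) x≤Y
... | inj₂ st′ = liftingʳ a (m≤x ◅◅ st ◅ ε) (m≤sx ◅◅ st′ ◅ ε) x≤Y

-- A step across the cut between positions c - 1 and c; unlike an arbitrary step, it remains a step
-- after conjugation by every s a with a ≢ c.
CrossStep : ∀ {n} → ℕ → Vec ℕ n → Vec ℕ n → Set
CrossStep {n} c z z′ = Σ (Fin n) λ i → Σ (Fin n) λ j →
  (toℕ i < c) × (c ≤ toℕ j) × (lookup z i > lookup z j) × (z′ ≡ swapPos i j z)

crossStep⇒step : ∀ {n c} {z z′ : Vec ℕ n} → CrossStep c z z′ → Step z z′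
crossStep⇒step (i , j , i<c , c≤j , zi>zj , eq) = i , j , <-≤-trans i<c c≤j , zi>zj , eq

crossStep-s : ∀ {n} a {c} {z z′ : Vec ℕ n} → a ≢ c → CrossStep c z z′ → CrossStep c (s a z) (s a z′)
crossStep-s a {c} {z} a≢c (i , j , i<c , c≤j , zi>zj , refl) =
  s-pos a i , s-pos a j , s-pos-<-cut a c i i<c a≢c , s-pos-≥-cut a c j c≤j a≢c ,
  subst₂ _>_ (sym (lookup-s-s-pos a z i)) (sym (lookup-s-s-pos a z j)) zi>zj ,
  s-swapPos a z (λ e → <⇒≢ (<-≤-trans i<c c≤j) (cong toℕ e))

crossStep-sw : ∀ {n c} A {z z′ : Vec ℕ n} → All (_≢ c) A →
               CrossStep c z z′ → CrossStep c (sw A z) (sw A z′)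
crossStep-sw [] [] st = st
crossStep-sw (a ∷ A) (a≢c ∷ A∌c) st = crossStep-s a a≢c (crossStep-sw A A∌c st)

-- inverted c z: z_c > z_(c+1) in 1-indexed terms, so that s c z is one step above z.
inverted : ∀ {n} → ℕ → Vec ℕ n → Bool
inverted 1 (x ∷ y ∷ v) = y <ᵇ x
inverted (suc (suc c)) (x ∷ v) = inverted (suc c) v
inverted _ v = false

inverted⇒crossStep : ∀ {n} c (z : Vec ℕ n) → inverted c z ≡ true → CrossStep c z (s c z)
inverted⇒crossStep 1 (x ∷ y ∷ v) inv =
  fzero , fsuc fzero , s≤s z≤n , s≤s z≤n , <ᵇ⇒< y x (subst T (sym inv) _) , refl
inverted⇒crossStep (suc (suc c)) (x ∷ v) inv with inverted⇒crossStep (suc c) v inv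
... | i , j , i<c , c≤j , vi>vj , eq = fsuc i , fsuc j , s≤s i<c , s≤s c≤j , vi>vj , cong (x ∷_) eq

<ᵇ≡false⇒≮ : ∀ {m n} → (m <ᵇ n) ≡ false → ¬ m < n
<ᵇ≡false⇒≮ e m<n = subst T e (<⇒<ᵇ m<n)

s-fixed : ∀ {n} c (z : Vec ℕ n) → inverted c z ≡ false → inverted c (s c z) ≡ false → s c z ≡ z
s-fixed 1 (x ∷ y ∷ v) ¬y<x ¬x<y
  with refl ← ≤-antisym (≮⇒≥ (<ᵇ≡false⇒≮ {y} ¬y<x)) (≮⇒≥ (<ᵇ≡false⇒≮ {x} ¬x<y)) = refl
s-fixed (suc (suc c)) (x ∷ v) ¬inv ¬inv′ = cong (x ∷_) (s-fixed (suc c) v ¬inv ¬inv′)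
s-fixed zero z _ _ = refl
s-fixed 1 [] _ _ = refl
s-fixed 1 (x ∷ []) _ _ = refl
s-fixed (suc (suc c)) [] _ _ = refl

sw-≤-s : ∀ {n c} A {z : Vec ℕ n} → All (_≢ c) A → inverted c z ≡ true → sw A z ≤B sw A (s c z)
sw-≤-s {c = c} A {z} A∌c inv = crossStep⇒step (crossStep-sw A A∌c (inverted⇒crossStep c z inv)) ◅ ε

sw-s-≤ : ∀ {n c} A {z : Vec ℕ n} → All (_≢ c) A → inverted c z ≡ false → sw A (s c z) ≤B sw A z
sw-s-≤ {c = c} A {z} A∌c ¬inv with inverted c (s c z) in inv
... | true = subst (λ t → sw A (s c z) ≤B sw A t) (s-involutive c z) (sw-≤-s A A∌c inv)
... | false = subst (λ t → sw A t ≤B sw A z) (sym (s-fixed c z ¬inv inv)) ε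

sw-++ : ∀ {n} A B (z : Vec ℕ n) → sw (A ++ B) z ≡ sw A (sw B z)
sw-++ [] B z = refl
sw-++ (a ∷ A) B z = cong (s a) (sw-++ A B z)

unique⇒∉prefix : ∀ A {c B} → Unique (A ++ c ∷ B) → All (_≢ c) A
unique⇒∉prefix [] _ = []
unique⇒∉prefix (a ∷ A) (a∉ ∷ u) = head (++⁻ʳ A a∉) ∷ unique⇒∉prefix A u

unique-delete : ∀ A {c B} → Unique (A ++ c ∷ B) → Unique (A ++ B)
unique-delete [] (_ ∷ u) = u
unique-delete (a ∷ A) (a∉ ∷ u) = ++⁺ (++⁻ˡ A a∉) (tail (++⁻ʳ A a∉)) ∷ unique-delete A u

AllSplits : (List ℕ → ℕ → List ℕ → Set) → List ℕ → Set
AllSplits P w = ∀ A c B → w ≡ A ++ c ∷ B → P A c B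

AllDeletions : (List ℕ → Set) → List ℕ → Set
AllDeletions Q = AllSplits (λ A _ B → Q (A ++ B))

Minimal : (List ℕ → Set) → List ℕ → Set
Minimal Q w = Q w × AllDeletions (¬_ ∘ Q) w

module _ {P : List ℕ → ℕ → List ℕ → Set} where

  allSplits-head : ∀ {c w} → AllSplits P (c ∷ w) → P [] c w
  allSplits-head h = h [] _ _ refl

  allSplits-tail : ∀ {c w} → AllSplits P (c ∷ w) → AllSplits (λ A → P (_ ∷ A)) w
  allSplits-tail h A c B refl = h (_ ∷ A) c B refl

  allSplits-∷ : ∀ {c w} → P [] c w → AllSplits (λ A → P (c ∷ A)) w → AllSplits P (c ∷ w)
  allSplits-∷ h t [] _ _ refl = h
  allSplits-∷ h t (a ∷ A) c B refl = t A c B refl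

  allSplits-++ʳ : ∀ A {w} → AllSplits P (A ++ w) → AllSplits (λ A′ → P (A ++ A′)) w
  allSplits-++ʳ A h A′ c B refl = h (A ++ A′) c B (sym (++-assoc A A′ (c ∷ B)))

allSplits-map : ∀ {P P′ : List ℕ → ℕ → List ℕ → Set} {w} →
                (∀ {A c B} → P A c B → P′ A c B) → AllSplits P w → AllSplits P′ w
allSplits-map f h A c B e = f (h A c B e)

-- Shared by the Bruhat order (Up) and its opposite (Down): good c z says that s c z lies above z,
-- op c z is the larger of z and s c z, and opW the resulting Demazure-type product.
module Directed {n : ℕ} (_≼_ : Vec ℕ n → Vec ℕ n → Set)
  (≼-refl : ∀ {z} → z ≼ z) (≼-trans : ∀ {x y z} → x ≼ y → y ≼ z → x ≼ z)
  (good : ℕ → Vec ℕ n → Bool)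
  (good-≼ : ∀ {c} A {z} → All (_≢ c) A → good c z ≡ true → sw A z ≼ sw A (s c z))
  (bad-≽ : ∀ {c} A {z} → All (_≢ c) A → good c z ≡ false → sw A (s c z) ≼ sw A z)
  (lifting : ∀ c {z y M} → z ≼ y → y ≼ M → s c y ≼ M → s c z ≼ M) where

  open import Data.List.Relation.Binary.Sublist.Propositional using ([]; _∷_; _∷ʳ_)

  op : ℕ → Vec ℕ n → Vec ℕ n
  op c z = if good c z then s c z else z

  opW : List ℕ → Vec ℕ n → Vec ℕ n
  opW [] z = z
  opW (c ∷ w) z = op c (opW w z)

  Ascending : Vec ℕ n → List ℕ → Set
  Ascending z = AllSplits (λ _ c B → good c (sw B z) ≡ true)

  op-bad : ∀ {c z} → good c z ≡ false → op c z ≡ z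
  op-bad g rewrite g = refl

  opW-++ : ∀ A B z → opW (A ++ B) z ≡ opW A (opW B z)
  opW-++ [] B z = refl
  opW-++ (a ∷ A) B z = cong (op a) (opW-++ A B z)

  ≼-op : ∀ c z → z ≼ op c z
  ≼-op c z with good c z in g
  ... | true = good-≼ [] [] g
  ... | false = ≼-refl

  s≼op : ∀ c z → s c z ≼ op c z
  s≼op c z with good c z in g
  ... | true = ≼-refl
  ... | false = bad-≽ [] [] g

  sw≼opW : ∀ w z → sw w z ≼ opW w z
  sw≼opW [] z = ≼-refl
  sw≼opW (c ∷ w) z = lifting c (sw≼opW w z) (≼-op c (opW w z)) (s≼op c (opW w z))

  opW-sublist : ∀ w z → ∃ λ w* → w* ⊆ w × opW w z ≡ sw w* z
  opW-sublist [] z = [] , [] , refl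
  opW-sublist (c ∷ w) z with opW-sublist w z | good c (opW w z)
  ... | w* , w*⊆w , eq | true = c ∷ w* , refl ∷ w*⊆w , cong (s c) eq
  ... | w* , w*⊆w , eq | false = w* , c ∷ʳ w*⊆w , eq

  opW-ascending : ∀ {z} w → Ascending z w → opW w z ≡ sw w z
  opW-ascending [] _ = refl
  opW-ascending (c ∷ w) ascs rewrite opW-ascending w (allSplits-tail ascs) | allSplits-head ascs = refl

  opW-≡-sw : ∀ {z} w → AllSplits (λ _ c B → good c (opW B z) ≡ true) w → opW w z ≡ sw w z
  opW-≡-sw [] _ = refl
  opW-≡-sw (c ∷ w) goods rewrite allSplits-head goods = cong (s c) (opW-≡-sw w (allSplits-tail goods))

  minimal⇒ascending : ∀ {b z w} → Unique w → Minimal (λ w → b ≼ sw w z) w → Ascending z w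
  minimal⇒ascending {b} {z} uw (b≼w , dels) A c B refl with good c (sw B z) in g
  ... | true = refl
  ... | false = ⊥-elim (dels A c B refl (subst (b ≼_) (sym (sw-++ A B z))
                  (≼-trans (subst (b ≼_) (sw-++ A (c ∷ B) z) b≼w) (bad-≽ A (unique⇒∉prefix A uw) g))))

  -- If X* is a sublist of X, reinserting its missing letters and then c only moves up, each letter
  -- being an ascent where it acts; insertion keeps the first missing letter out, so that the end
  -- point is a one-letter deletion of X ++ c ∷ B.
  reinsert : ∀ P {X* X} c B {z} → X* ⊆ X → Unique (P ++ X ++ c ∷ B) → Ascending z (X ++ c ∷ B) →
             sw P (sw X* (sw B z)) ≼ sw P (sw (X ++ c ∷ B) z)
  reinsert P c B [] u ascs = good-≼ P (unique⇒∉prefix P u) (allSplits-head ascs)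
  reinsert P {a ∷ X*} {a ∷ X} c B {z} (refl ∷ X*⊆X) u ascs =
    subst₂ _≼_ (sw-++ P (a ∷ []) _) (sw-++ P (a ∷ []) _)
      (reinsert (P ++ a ∷ []) c B X*⊆X (subst Unique (sym (++-assoc P (a ∷ []) _)) u) (allSplits-tail ascs))
  reinsert P {X*} {a ∷ X} c B (.a ∷ʳ X*⊆X) u ascs =
    ≼-trans (reinsert P c B X*⊆X (unique-delete P u) (allSplits-tail ascs))
            (good-≼ P (unique⇒∉prefix P u) (allSplits-head ascs))

  insertion : ∀ P {X* X} c B {b z} → X* ⊆ X → Unique (P ++ X ++ c ∷ B) → Ascending z (X ++ c ∷ B) →
              AllDeletions (λ w → ¬ b ≼ sw P (sw w z)) (X ++ c ∷ B) → ¬ b ≼ sw P (sw X* (sw B z))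
  insertion P c B [] u ascs dels = allSplits-head dels
  insertion P {a ∷ X*} {a ∷ X} c B {b} (refl ∷ X*⊆X) u ascs dels b≼ =
    insertion (P ++ a ∷ []) c B X*⊆X (subst Unique (sym (++-assoc P (a ∷ []) _)) u) (allSplits-tail ascs)
      (allSplits-map (λ ¬b≼ b≼′ → ¬b≼ (subst (b ≼_) (sw-++ P (a ∷ []) _) b≼′)) (allSplits-tail dels))
      (subst (b ≼_) (sym (sw-++ P (a ∷ []) _)) b≼)
  insertion P {X*} {a ∷ X} c B (.a ∷ʳ X*⊆X) u ascs dels b≼ =
    allSplits-head dels (≼-trans b≼ (reinsert P c B X*⊆X (unique-delete P u) (allSplits-tail ascs)))

  opW-minimal : ∀ {b z w} → Minimal (λ w → b ≼ opW w z) w → opW w z ≡ sw w z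
  opW-minimal {b} {z} {w} (b≼w , dels) = opW-≡-sw w goods
    where
    goods : AllSplits (λ _ c B → good c (opW B z) ≡ true) w
    goods A c B refl with good c (opW B z) in g
    ... | true = refl
    ... | false = ⊥-elim (dels A c B refl (subst (b ≼_) drop-c b≼w))
      where
      open ≡-Reasoning
      drop-c : opW (A ++ c ∷ B) z ≡ opW (A ++ B) z
      drop-c = begin
        opW (A ++ c ∷ B) z        ≡⟨ opW-++ A (c ∷ B) z ⟩
        opW A (op c (opW B z))    ≡⟨ cong (opW A) (op-bad g) ⟩
        opW A (opW B z)           ≡⟨ opW-++ A B z ⟨
        opW (A ++ B) z            ∎

  minimal-opW⇒minimal-sw : ∀ {b z w} → Minimal (λ w → b ≼ opW w z) w → Minimal (λ w → b ≼ sw w z) w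
  minimal-opW⇒minimal-sw {b} {z} m@(b≼w , dels) =
    subst (b ≼_) (opW-minimal m) b≼w ,
    allSplits-map (λ {A} {_} {B} ¬b≼ b≼ → ¬b≼ (≼-trans b≼ (sw≼opW (A ++ B) z))) dels

  minimal-sw⇒minimal-opW : ∀ {b z w} → Unique w →
                           Minimal (λ w → b ≼ sw w z) w → Minimal (λ w → b ≼ opW w z) w
  minimal-sw⇒minimal-opW {b} {z} {w} uw m@(b≼w , dels) =
    subst (b ≼_) (sym (opW-ascending w ascending)) b≼w , dels′
    where
    ascending : Ascending z w
    ascending = minimal⇒ascending uw m
    dels′ : AllDeletions (λ w′ → ¬ b ≼ opW w′ z) w
    dels′ A c B refl b≼ with opW-sublist A (sw B z)
    ... | A* , A*⊆A , eq = insertion [] c B A*⊆A uw ascending dels (subst (b ≼_) opW-A++B b≼)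
      where
      open ≡-Reasoning
      opW-A++B : opW (A ++ B) z ≡ sw A* (sw B z)
      opW-A++B = begin
        opW (A ++ B) z      ≡⟨ opW-++ A B z ⟩
        opW A (opW B z)     ≡⟨ cong (opW A) (opW-ascending B (allSplits-tail (allSplits-++ʳ A ascending))) ⟩
        opW A (sw B z)      ≡⟨ eq ⟩
        sw A* (sw B z)      ∎

Tight : (List ℕ → List ℕ → Set) → List ℕ → List ℕ → Set
Tight R u v = Minimal (λ u′ → R u′ v) u × Minimal (R u) v

module _ (R : List ℕ → List ℕ → Set) (shift : ∀ c u v → R u (c ∷ v) ⇔ R (c ∷ u) v) where

  tight-shift : ∀ c u v → Tight R u (c ∷ v) ⇔ Tight R (c ∷ u) v
  tight-shift c u v = mk⇔ forward backward
    where
    open Equivalence using (to; from)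
    forward : Tight R u (c ∷ v) → Tight R (c ∷ u) v
    forward ((r , dels-u) , (_ , dels-cv)) =
      (r′ , allSplits-∷ (allSplits-head dels-cv) (allSplits-map (λ ¬r → ¬r ∘ from (shift c _ v)) dels-u)) ,
      (r′ , allSplits-map (λ ¬r → ¬r ∘ from (shift c u _)) (allSplits-tail dels-cv))
      where r′ = to (shift c u v) r
    backward : Tight R (c ∷ u) v → Tight R u (c ∷ v)
    backward ((r , dels-cu) , (_ , dels-v)) =
      (r′ , allSplits-map (λ ¬r → ¬r ∘ to (shift c _ v)) (allSplits-tail dels-cu)) ,
      (r′ , allSplits-∷ (allSplits-head dels-cu) (allSplits-map (λ ¬r → ¬r ∘ to (shift c u _)) dels-v))
      where r′ = from (shift c u v) r

module Up {n : ℕ} = Directed {n} _≤B_ ε _◅◅_ inverted sw-≤-s sw-s-≤ liftingˡ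

module Down {n : ℕ} = Directed {n} (λ x y → y ≤B x) ε (λ x≥y y≥z → y≥z ◅◅ x≥y)
  (λ c → inverted c ∘ s c)
  (λ {c} A {z} A∌c inv →
     subst (λ t → sw A (s c z) ≤B sw A t) (s-involutive c z) (sw-≤-s A A∌c inv))
  (λ {c} A {z} A∌c ¬inv →
     subst (λ t → sw A t ≤B sw A (s c z)) (s-involutive c z) (sw-s-≤ A A∌c ¬inv))
  (λ c y≤z M≤y M≤sy → liftingʳ c M≤y M≤sy y≤z)

raise lower : ∀ {n} → ℕ → Vec ℕ n → Vec ℕ n
raise = Up.op
lower = Down.op

lower-≤⇒≤-raise : ∀ {n} c {x Y : Vec ℕ n} → lower c x ≤B Y → x ≤B raise c Y
lower-≤⇒≤-raise c {x} {Y} lx≤Y with inverted c (s c x) in inv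
... | true = subst (_≤B raise c Y) (s-involutive c x) (liftingˡ c lx≤Y (Up.≼-op c Y) (Up.s≼op c Y))
... | false = lx≤Y ◅◅ Up.≼-op c Y

≤-raise⇒lower-≤ : ∀ {n} c {x Y : Vec ℕ n} → x ≤B raise c Y → lower c x ≤B Y
≤-raise⇒lower-≤ c {x} {Y} x≤rY with inverted c Y in inv
... | true = subst (lower c x ≤B_) (s-involutive c Y) (liftingʳ c (Down.≼-op c x) (Down.s≼op c x) x≤rY)
... | false = Down.≼-op c x ◅◅ x≤rY

SwLe OpLe : ∀ {n} → Vec ℕ n → Vec ℕ n → List ℕ → List ℕ → Set
SwLe x y u v = sw u x ≤B sw v y
OpLe x y u v = Down.opW u x ≤B Up.opW v y

opLe-shift : ∀ {n} (x y : Vec ℕ n) c u v → OpLe x y u (c ∷ v) ⇔ OpLe x y (c ∷ u) v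
opLe-shift x y c u v = mk⇔ (≤-raise⇒lower-≤ c) (lower-≤⇒≤-raise c)

tight-sw⇔tight-op : ∀ {n} (x y : Vec ℕ n) {u v} → Unique u → Unique v →
                    Tight (SwLe x y) u v ⇔ Tight (OpLe x y) u v
tight-sw⇔tight-op x y {u} {v} uu uv = mk⇔ forward backward
  where
  forward : Tight (SwLe x y) u v → Tight (OpLe x y) u v
  forward (mu , mv) =
    subst (λ t → Minimal (λ u′ → Down.opW u′ x ≤B t) u) (sym (Up.opW-minimal mv′)) mu′ ,
    subst (λ t → Minimal (λ v′ → t ≤B Up.opW v′ y) v) (sym (Down.opW-minimal mu′)) mv′
    where
    mu′ = Down.minimal-sw⇒minimal-opW uu mu
    mv′ = Up.minimal-sw⇒minimal-opW uv mv
  backward : Tight (OpLe x y) u v → Tight (SwLe x y) u v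
  backward (mu , mv) =
    subst (λ t → Minimal (λ u′ → sw u′ x ≤B t) u) (Up.opW-minimal mv) (Down.minimal-opW⇒minimal-sw mu) ,
    subst (λ t → Minimal (λ v′ → t ≤B sw v′ y) v) (Down.opW-minimal mu) (Up.minimal-opW⇒minimal-sw mv)

≡ᵇ-true : ∀ {x i} → x ≡ i → (x ≡ᵇ i) ≡ true
≡ᵇ-true {x} {i} x≡i = Equivalence.to T-≡ (≡⇒≡ᵇ x i x≡i)

≡ᵇ-false : ∀ {x i} → x ≢ i → (x ≡ᵇ i) ≡ false
≡ᵇ-false {x} {i} x≢i = ¬-not (x≢i ∘ ≡ᵇ⇒≡ x i ∘ Equivalence.from T-≡)

omit-here : ∀ i L → omit i (i ∷ L) ≡ omit i L
omit-here i L rewrite ≡ᵇ-true {i} refl = refl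

omit-there : ∀ {i x} L → x ≢ i → omit i (x ∷ L) ≡ x ∷ omit i L
omit-there L x≢i rewrite ≡ᵇ-false x≢i = refl

omit-∉ : ∀ {i L} → All (i ≢_) L → omit i L ≡ L
omit-∉ [] = refl
omit-∉ {i} {x ∷ L} (i≢x ∷ i∉L) = trans (omit-there L (i≢x ∘ sym)) (cong (x ∷_) (omit-∉ i∉L))

all-omit : ∀ {P : ℕ → Set} i {L} → All P L → All P (omit i L)
all-omit i = filter⁺ (T? ∘ (λ j → not (j ≡ᵇ i)))

module _ (f : ℕ → ℕ) where

  omit⇒deletions : ∀ (Q : List ℕ → Set) {L} → Unique L →
                   (∀ i → i ∈ L → Q (map f (omit i L))) → AllDeletions Q (map f L)
  omit⇒deletions Q {[]} _ _ [] _ _ ()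
  omit⇒deletions Q {[]} _ _ (_ ∷ _) _ _ ()
  omit⇒deletions Q {x ∷ L} (x∉L ∷ uL) h =
    allSplits-∷ (subst (Q ∘ map f) (trans (omit-here x L) (omit-∉ x∉L)) (h x (here refl)))
      (omit⇒deletions (Q ∘ (f x ∷_)) uL λ i i∈L →
        subst (Q ∘ map f) (omit-there L (All.lookup x∉L i∈L)) (h i (there i∈L)))

  deletions⇒omit : ∀ (Q : List ℕ → Set) {L} → Unique L →
                   AllDeletions Q (map f L) → ∀ i → i ∈ L → Q (map f (omit i L))
  deletions⇒omit Q {x ∷ L} (x∉L ∷ uL) dels .x (here refl) =
    subst (Q ∘ map f) (sym (trans (omit-here x L) (omit-∉ x∉L))) (allSplits-head dels)
  deletions⇒omit Q {x ∷ L} (x∉L ∷ uL) dels i (there i∈L) =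
    subst (Q ∘ map f) (sym (omit-there L (All.lookup x∉L i∈L)))
      (deletions⇒omit (Q ∘ (f x ∷_)) uL (allSplits-tail dels) i i∈L)

+-<-∸ : ∀ a {j m} → j < m ∸ a → a + j < m
+-<-∸ a {j} {m} j<m∸a with a ≤? m
... | yes a≤m = subst (a + j <_) (m+[n∸m]≡n a≤m) (+-monoʳ-< a j<m∸a)
... | no a≰m with () ← subst (j <_) (m≤n⇒m∸n≡0 (<⇒≤ (≰⇒> a≰m))) j<m∸a

∈-asc : ∀ {a b i} → i ∈ asc a b ⇔ (a ≤ i × i ≤ b)
∈-asc {a} {b} {i} = mk⇔ bounded member
  where
  bounded : i ∈ asc a b → a ≤ i × i ≤ b
  bounded i∈ with j , j∈ , refl ← ∈-map⁻ (a +_) i∈ = m≤m+n a j , ≤-pred (+-<-∸ a (∈-upTo⁻ j∈))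
  member : a ≤ i × i ≤ b → i ∈ asc a b
  member (a≤i , i≤b) =
    subst (_∈ asc a b) (m+[n∸m]≡n a≤i) (∈-map⁺ (a +_) (∈-upTo⁺ (∸-monoˡ-< (s≤s i≤b) a≤i)))

∈-desc : ∀ {a b i} → i ∈ desc a b ⇔ (a ≤ i × i ≤ b)
∈-desc = mk⇔ (Equivalence.to ∈-asc ∘ reverse⁻) (reverse⁺ ∘ Equivalence.from ∈-asc)

asc-∷ : ∀ {a b} → a ≤ b → asc a b ≡ a ∷ asc (suc a) b
asc-∷ {a} {b} a≤b = begin
  map (a +_) (upTo (suc b ∸ a))          ≡⟨ cong (map (a +_) ∘ upTo) (+-∸-assoc 1 a≤b) ⟩
  a + 0 ∷ map (a +_) (applyUpTo suc m)   ≡⟨ cong₂ _∷_ (+-identityʳ a) (cong (map (a +_)) (sym (map-upTo suc m))) ⟩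
  a ∷ map (a +_) (map suc (upTo m))      ≡⟨ cong (a ∷_) (map-∘ (upTo m)) ⟨
  a ∷ map ((a +_) ∘ suc) (upTo m)        ≡⟨ cong (a ∷_) (map-cong (+-suc a) (upTo m)) ⟩
  a ∷ asc (suc a) b                      ∎
  where
  open ≡-Reasoning
  m = b ∸ a

asc-empty : ∀ {a b} → b < a → asc a b ≡ []
asc-empty {a} b<a = cong (map (a +_) ∘ upTo) (m≤n⇒m∸n≡0 b<a)

desc-applyDownFrom : ∀ a b → desc a b ≡ applyDownFrom (a +_) (suc b ∸ a)
desc-applyDownFrom a b =
  trans (cong reverse (map-upTo (a +_) (suc b ∸ a))) (reverse-applyUpTo (a +_) (suc b ∸ a))

desc-∷ : ∀ q → desc 1 (suc q) ≡ suc q ∷ desc 1 q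
desc-∷ q = trans (desc-applyDownFrom 1 (suc q)) (cong (suc q ∷_) (sym (desc-applyDownFrom 1 q)))

asc-unique : ∀ a b → Unique (asc a b)
asc-unique a b = Unique.map⁺ (+-cancelˡ-≡ a _ _) (Unique.upTo⁺ (suc b ∸ a))

desc-unique : ∀ a b → Unique (desc a b)
desc-unique a b = subst Unique (sym (desc-applyDownFrom a b))
  (Unique.applyDownFrom⁺₁ (a +_) (suc b ∸ a) (λ j<i _ e → <⇒≢ j<i (sym (+-cancelˡ-≡ a _ _ e))))

module _ where
  open import Data.Vec using (_∷ʳ_)

  s-∷ʳ : ∀ {m} a (v : Vec ℕ m) x → a < m → s a (v ∷ʳ x) ≡ s a v ∷ʳ x
  s-∷ʳ zero v x _ = refl
  s-∷ʳ 1 (y ∷ z ∷ v) x _ = refl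
  s-∷ʳ 1 (y ∷ []) x (s≤s ())
  s-∷ʳ (suc (suc a)) (y ∷ v) x (s≤s a<m) = cong (y ∷_) (s-∷ʳ (suc a) v x a<m)

  s-last : ∀ {m} (v : Vec ℕ m) y x → s (suc m) ((v ∷ʳ y) ∷ʳ x) ≡ (v ∷ʳ x) ∷ʳ y
  s-last [] y x = refl
  s-last (z ∷ v) y x = cong (z ∷_) (s-last v y x)

  ω-s : ∀ {n} c (v : Vec ℕ n) → 1 ≤ c → c < n → ω (s c v) ≡ s (n ∸ c) (ω v)
  ω-s 1 (x ∷ y ∷ v) _ _ = begin
    ω (y ∷ x ∷ v)               ≡⟨ reverse-∷ y (x ∷ v) ⟩
    ω (x ∷ v) ∷ʳ y              ≡⟨ cong (_∷ʳ y) (reverse-∷ x v) ⟩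
    (ω v ∷ʳ x) ∷ʳ y             ≡⟨ s-last (ω v) y x ⟨
    s _ ((ω v ∷ʳ y) ∷ʳ x)       ≡⟨ cong (λ t → s _ (t ∷ʳ x)) (reverse-∷ y v) ⟨
    s _ (ω (y ∷ v) ∷ʳ x)        ≡⟨ cong (s _) (reverse-∷ x (y ∷ v)) ⟨
    s _ (ω (x ∷ y ∷ v))         ∎
    where open ≡-Reasoning
  ω-s 1 (x ∷ []) _ (s≤s ())
  ω-s {suc n} (suc (suc c)) (x ∷ v) _ (s≤s c<n) = begin
    ω (x ∷ s (suc c) v)          ≡⟨ reverse-∷ x (s (suc c) v) ⟩
    ω (s (suc c) v) ∷ʳ x         ≡⟨ cong (_∷ʳ x) (ω-s (suc c) v (s≤s z≤n) c<n) ⟩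
    s (n ∸ suc c) (ω v) ∷ʳ x     ≡⟨ s-∷ʳ (n ∸ suc c) (ω v) x (∸-monoʳ-< {n} (s≤s z≤n) (<⇒≤ c<n)) ⟨
    s (n ∸ suc c) (ω v ∷ʳ x)     ≡⟨ cong (s (n ∸ suc c)) (reverse-∷ x v) ⟨
    s (n ∸ suc c) (ω (x ∷ v))    ∎
    where open ≡-Reasoning

  ω-sw : ∀ {n} w (v : Vec ℕ n) → All (λ c → 1 ≤ c × c < n) w → ω (sw w v) ≡ sw (map (n ∸_) w) (ω v)
  ω-sw [] v [] = refl
  ω-sw {n} (c ∷ w) v ((1≤c , c<n) ∷ w-range) =
    trans (ω-s c (sw w v) 1≤c c<n) (cong (s (n ∸ c)) (ω-sw w v w-range))

unique-map-on : ∀ {P : ℕ → Set} {f : ℕ → ℕ} {L} → (∀ {i j} → P i → P j → f i ≡ f j → i ≡ j) →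
                All P L → Unique L → Unique (map f L)
unique-map-on f-inj [] [] = []
unique-map-on {f = f} f-inj (pi ∷ pL) (i∉L ∷ uL) = distinct pL i∉L ∷ unique-map-on f-inj pL uL
  where
  distinct : ∀ {L} → All _ L → All (_ ≢_) L → All (f _ ≢_) (map f L)
  distinct [] [] = []
  distinct (pj ∷ pL) (i≢j ∷ i∉L) = i≢j ∘ f-inj pi pj ∷ distinct pL i∉L

∀-∈ : ∀ {L a b} {X : ℕ → Set} → (∀ {i} → i ∈ L ⇔ (a ≤ i × i ≤ b)) →
      (∀ i → a ≤ i → i ≤ b → X i) ⇔ (∀ i → i ∈ L → X i)
∀-∈ mem = mk⇔ (λ h i i∈L → uncurry (h i) (Equivalence.to mem i∈L))
              (λ h i a≤i i≤b → h i (Equivalence.from mem (a≤i , i≤b)))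

module Conditions {n : ℕ} (ν β : Vec ℕ n) (k : ℕ) (r : ℕ → ℕ)
  (r-range : ∀ j → 1 ≤ j → j ≤ k → (1 ≤ r j) × (r j < n))
  (r-step : ∀ j → 1 ≤ j → j < k → r j < r (suc j)) where

  open Equivalence using (to; from)
  open ≈-Reasoning (⇔-setoid 0ℓ)

  μ : Vec ℕ n
  μ = ω ν

  g : ℕ → ℕ
  g j = n ∸ r j

  InRange : ℕ → Set
  InRange j = 1 ≤ j × j ≤ k

  r-mono : ∀ {i} j → 1 ≤ i → i < j → j ≤ k → r i < r j
  r-mono {i} (suc j) 1≤i i<1+j 1+j≤k with m<1+n⇒m<n∨m≡n i<1+j
  ... | inj₂ refl = r-step i 1≤i 1+j≤k
  ... | inj₁ i<j = <-trans (r-mono j 1≤i i<j (<⇒≤ 1+j≤k)) (r-step j (≤-trans 1≤i (<⇒≤ i<j)) 1+j≤k)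

  r-injective : ∀ {i j} → InRange i → InRange j → r i ≡ r j → i ≡ j
  r-injective {i} {j} (1≤i , i≤k) (1≤j , j≤k) ri≡rj with <-cmp i j
  ... | tri< i<j _ _ = ⊥-elim (<-irrefl ri≡rj (r-mono j 1≤i i<j j≤k))
  ... | tri≈ _ i≡j _ = i≡j
  ... | tri> _ _ j<i = ⊥-elim (<-irrefl (sym ri≡rj) (r-mono i 1≤j j<i i≤k))

  g-injective : ∀ {i j} → InRange i → InRange j → g i ≡ g j → i ≡ j
  g-injective i-range j-range = r-injective i-range j-range ∘ ∸-cancelˡ-≡ (r≤n i-range) (r≤n j-range)
    where
    r≤n : ∀ {j} → InRange j → r j ≤ n
    r≤n {j} (1≤j , j≤k) = <⇒≤ (proj₂ (r-range j 1≤j j≤k))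

  ω-sw-r : ∀ {W} → All InRange W → ω (sw (map r W) ν) ≡ sw (map g W) μ
  ω-sw-r {W} W-range =
    trans (ω-sw (map r W) ν (map⁺ (All.map (λ {j} (1≤j , j≤k) → r-range j 1≤j j≤k) W-range)))
          (cong (λ w → sw w μ) (sym (map-∘ W)))

  -- Condition (c) with U the indices of the letters applied to β and V those applied to ν.
  Cond : List ℕ → List ℕ → Set
  Cond U V = (∀ i → i ∈ V → sw (map g U) β ≰B ω (sw (map r (omit i V)) ν))
           × (∀ i → i ∈ U → sw (map g (omit i U)) β ≰B ω (sw (map r V) ν))
           × (sw (map g U) β ≤B ω (sw (map r V) ν))

  cond⇔tight : ∀ {U V} → Unique U → Unique V → All InRange U → All InRange V →
               Cond U V ⇔ Tight (SwLe β μ) (map g U) (map g V)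
  cond⇔tight {U} {V} uU uV U-range V-range = mk⇔ forward backward
    where
    ω-V : ω (sw (map r V) ν) ≡ sw (map g V) μ
    ω-V = ω-sw-r V-range
    ω-omit-V : ∀ i → ω (sw (map r (omit i V)) ν) ≡ sw (map g (omit i V)) μ
    ω-omit-V i = ω-sw-r (all-omit i V-range)
    Qᵤ Qᵥ : List ℕ → Set
    Qᵤ u′ = ¬ (sw u′ β ≤B sw (map g V) μ)
    Qᵥ v′ = ¬ (sw (map g U) β ≤B sw v′ μ)
    forward : Cond U V → Tight (SwLe β μ) (map g U) (map g V)
    forward (¬≤-omit-V , ¬≤-omit-U , ≤) =
      (≤′ , omit⇒deletions g Qᵤ uU λ i i∈U → ¬≤-omit-U i i∈U ∘ subst (_ ≤B_) (sym ω-V)) ,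
      (≤′ , omit⇒deletions g Qᵥ uV λ i i∈V → ¬≤-omit-V i i∈V ∘ subst (_ ≤B_) (sym (ω-omit-V i)))
      where ≤′ = subst (_ ≤B_) ω-V ≤
    backward : Tight (SwLe β μ) (map g U) (map g V) → Cond U V
    backward ((≤ , dels-U) , (_ , dels-V)) =
      (λ i i∈V → deletions⇒omit g Qᵥ uV dels-V i i∈V ∘ subst (_ ≤B_) (ω-omit-V i)) ,
      (λ i i∈U → deletions⇒omit g Qᵤ uU dels-U i i∈U ∘ subst (_ ≤B_) ω-V) ,
      subst (_ ≤B_) (sym ω-V) ≤

  gAsc gDesc : ℕ → List ℕ
  gAsc q = map g (asc (suc q) k)
  gDesc q = map g (desc 1 q)

  -- Level q is condition (c) for p = k ∸ q, with the operator products in place of s_u β and s_v μ.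
  Level : ℕ → Set
  Level q = Tight (OpLe β μ) (gAsc q) (gDesc q)

  level-invariant : ∀ q → q ≤ k → Level 0 ⇔ Level q
  level-invariant zero _ = mk⇔ (λ t → t) (λ t → t)
  level-invariant (suc q) q<k = begin
    Level 0                                        ≈⟨ level-invariant q (<⇒≤ q<k) ⟩
    Level q                                        ≡⟨ cong (λ u → Tight R u (gDesc q)) (cong (map g) (asc-∷ q<k)) ⟩
    Tight R (g (suc q) ∷ gAsc (suc q)) (gDesc q)   ≈⟨ tight-shift R (opLe-shift β μ) _ _ _ ⟨
    Tight R (gAsc (suc q)) (g (suc q) ∷ gDesc q)   ≡⟨ cong (Tight R (gAsc (suc q))) (cong (map g) (desc-∷ q)) ⟨
    Level (suc q)                                  ∎
    where R = OpLe β μ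

  cond⇔level-0 : ∀ q → q ≤ k → Cond (asc (suc q) k) (desc 1 q) ⇔ Level 0
  cond⇔level-0 q q≤k = begin
    Cond (asc (suc q) k) (desc 1 q)       ≈⟨ cond⇔tight (asc-unique _ k) (desc-unique 1 q) A-range D-range ⟩
    Tight (SwLe β μ) (gAsc q) (gDesc q)   ≈⟨ tight-sw⇔tight-op β μ (distinct A-range (asc-unique _ k))
                                                                    (distinct D-range (desc-unique 1 q)) ⟩
    Level q                               ≈⟨ level-invariant q q≤k ⟨
    Level 0                               ∎
    where
    A-range : All InRange (asc (suc q) k)
    A-range = All.tabulate λ i∈A → let (q<i , i≤k) = to ∈-asc i∈A in ≤-trans (s≤s z≤n) q<i , i≤k
    D-range : All InRange (desc 1 q)
    D-range = All.tabulate λ i∈D → let (1≤i , i≤q) = to ∈-desc i∈D in 1≤i , ≤-trans i≤q q≤k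
    distinct : ∀ {L} → All InRange L → Unique L → Unique (map g L)
    distinct = unique-map-on g-injective

  condA⇔level-0 : condA n ν β k r ⇔ Level 0
  condA⇔level-0 = begin
    condA n ν β k r                   ≈⟨ mk⇔ (λ (a₁ , a₂) → to (∀-∈ ∈-desc) a₁ , (λ _ ()) , a₂)
                                             (λ (c₁ , _ , c₃) → from (∀-∈ ∈-desc) c₁ , c₃) ⟩
    Cond [] (desc 1 k)                ≡⟨ cong (λ U → Cond U (desc 1 k)) (asc-empty ≤-refl) ⟨
    Cond (asc (suc k) k) (desc 1 k)   ≈⟨ cond⇔level-0 k ≤-refl ⟩
    Level 0                           ∎

  condB⇔level-0 : condB n ν β k r ⇔ Level 0
  condB⇔level-0 = begin
    condB n ν β k r                   ≈⟨ mk⇔ (λ (b₁ , b₂) → (λ _ ()) , to (∀-∈ ∈-asc) b₁ , b₂)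
                                             (λ (_ , c₂ , c₃) → from (∀-∈ ∈-asc) c₂ , c₃) ⟩
    Cond (asc 1 k) []                 ≈⟨ cond⇔level-0 0 z≤n ⟩
    Level 0                           ∎

  condC⇔level-0 : ∀ p → condC n ν β k p r ⇔ Level 0
  condC⇔level-0 p = begin
    condC n ν β k p r                 ≈⟨ mk⇔ (λ (c₁ , c₂ , c₃) → to (∀-∈ ∈-desc) c₁ , to (∀-∈ ∈-asc) c₂ , c₃)
                                             (λ (c₁ , c₂ , c₃) → from (∀-∈ ∈-desc) c₁ , from (∀-∈ ∈-asc) c₂ , c₃) ⟩
    Cond (asc (suc q) k) (desc 1 q)   ≈⟨ cond⇔level-0 q (m∸n≤m k p) ⟩
    Level 0                           ∎
    where q = k ∸ p

lemma4 : (n : ℕ) (ν β : Vec ℕ n) (k p : ℕ) (r : ℕ → ℕ) →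
    p ≤ k → k < n →
    (∀ j → 1 ≤ j → j ≤ k → (1 ≤ r j) × (r j < n)) →
    (∀ j → 1 ≤ j → j < k → r j < r (suc j)) →
    (condA n ν β k r ⇔ condB n ν β k r) × (condA n ν β k r ⇔ condC n ν β k p r)
lemma4 n ν β k p r _ _ r-range r-step =
  ⇔-sym condB⇔level-0 ⇔-∘ condA⇔level-0 , ⇔-sym (condC⇔level-0 p) ⇔-∘ condA⇔level-0
  where open Conditions ν β k r r-range r-step
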